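{- Let $m_1,m_2$ be reactive parallel monitors and $t\in\mathit{Act}^\omega$. Then: (1) $m_1\otimes m_2$ rejects $t$ iff $m_1$ rejects $t$ or $m_2$ rejects $t$; (2) $m_1\otimes m_2$ accepts $t$ iff both $m_1$ and $m_2$ accept $t$; (3) $m_1\oplus m_2$ rejects $t$ iff both $m_1$ and $m_2$ reject $t$; (4) $m_1\oplus m_2$ accepts $t$ iff $m_1$ accepts $t$ or $m_2$ accepts $t$.
   Context: Fix a finite set $\mathit{Act}$ of external actions and $\tau\notin\mathit{Act}$; $\mu$ ranges over $\mathit{Act}\cup\{\tau\}$. Parallel monitors: $m,n ::= v \mid a.m \mid m+n \mid \mathrm{rec}\,x.m \mid x \mid m\otimes n \mid m\oplus n$, verdicts $v::=\mathsf{end}\mid\mathsf{no}\mid\mathsf{yes}$; $\odot$ ranges over $\{\otimes,\oplus\}$. Transitions are the least relation with: $a.m\xrightarrow{a}m$; $\mathrm{rec}\,x.m\xrightarrow{\tau}m[\mathrm{rec}\,x.m/x]$; if $m\xrightarrow{\mu}m'$ then $m+n\xrightarrow{\mu}m'$ and $n+m\xrightarrow{\mu}m'$; $v\xrightarrow{a}v$ for all verdicts $v$, $a\in\mathit{Act}$; if $m\xrightarrow{a}m'$ and $n\xrightarrow{a}n'$ then $m\odot n\xrightarrow{a}m'\odot n'$; if $m\xrightarrow{\tau}m'$ then $m\odot n\xrightarrow{\tau}m'\odot n$ and $n\odot m\xrightarrow{\tau}n\odot m'$; $\mathsf{end}\odot\mathsf{end}\xrightarrow{\tau}\mathsf{end}$;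 $\mathsf{yes}\otimes m\xrightarrow{\tau}m$, $m\otimes\mathsf{yes}\xrightarrow{\tau}m$, $\mathsf{no}\otimes m\xrightarrow{\tau}\mathsf{no}$, $m\otimes\mathsf{no}\xrightarrow{\tau}\mathsf{no}$, $\mathsf{no}\oplus m\xrightarrow{\tau}m$, $m\oplus\mathsf{no}\xrightarrow{\tau}m$, $\mathsf{yes}\oplus m\xrightarrow{\tau}\mathsf{yes}$, $m\oplus\mathsf{yes}\xrightarrow{\tau}\mathsf{yes}$. Weak transitions: $m\Rightarrow n$ means $m(\xrightarrow{\tau})^*n$; $m\xRightarrow{a}n$ means $m\Rightarrow\xrightarrow{a}\Rightarrow n$; for $s=a_1\cdots a_k\in\mathit{Act}^*$, $m\xRightarrow{s}n$ means $m\xRightarrow{a_1}\cdots\xRightarrow{a_k}n$ (and $m\Rightarrow n$ for $s=\varepsilon$); $m\xRightarrow{a}$ means $m\xRightarrow{a}n$ for some $n$. The set $\mathrm{reach}(m)$ consists of all monitors reachable from $m$ by finitely many transitions. A monitor $m$ is reactive if for every $n\in\mathrm{reach}(m)$ and $a\in\mathit{Act}$, $n\xRightarrow{a}$. A monitor $m$ rejects (resp. accepts) an infinite trace $t$ if there is a finite prefix $s$ of $t$ with $m\xRightarrow{s}\mathsf{no}$ (resp. $m\xRightarrow{s}\mathsf{yes}$). -}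

module Defs where

open import Data.Nat using (ℕ; zero; suc; _<ᵇ_; compare; less; equal; greater)
import Data.Nat
open import Data.Fin using (Fin)
open import Data.Bool using (if_then_else_)
open import Data.List using (List; []; _∷_)
open import Data.Product using (∃; Σ; _×_; _,_)
open import Data.Sum using (_⊎_)
open import Relation.Binary.Construct.Closure.ReflexiveTransitive using (Star)

module Monitors (k : ℕ) where

  Act : Set
  Act = Fin k

  data Verdict : Set where
    end no yes : Verdict

  -- Parallel monitors; recursion variables are de Bruijn indices
  -- (rec binds index 0).
  data Mon : Set where
    verd : Verdict → Mon
    _∙_  : Act → Mon → Mon
    _+_  : Mon → Mon → Mon
    rec  : Mon → Mon
    var  : ℕ → Mon
    _⊗_  : Mon → Mon → Mon
    _⊕_  : Mon → Mon → Mon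

  shift : ℕ → Mon → Mon
  shift c (verd v) = verd v
  shift c (a ∙ m) = a ∙ shift c m
  shift c (m + n) = shift c m + shift c n
  shift c (rec m) = rec (shift (suc c) m)
  shift c (var i) = if i <ᵇ c then var i else var (suc i)
  shift c (m ⊗ n) = shift c m ⊗ shift c n
  shift c (m ⊕ n) = shift c m ⊕ shift c n

  subst : ℕ → Mon → Mon → Mon
  subst j s (verd v) = verd v
  subst j s (a ∙ m) = a ∙ subst j s m
  subst j s (m + n) = subst j s m + subst j s n
  subst j s (rec m) = rec (subst (suc j) (shift 0 s) m)
  subst j s (var i) with compare i j
  ... | less _ _ = var i
  ... | equal _ = s
  ... | greater _ l = var (j Data.Nat.+ l)   -- i = suc (j + l)  ↦  j + l (decrement)
  subst j s (m ⊗ n) = subst j s m ⊗ subst j s n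
  subst j s (m ⊕ n) = subst j s m ⊕ subst j s n

  unfold : Mon → Mon
  unfold m = subst 0 (rec m) m

  data Label : Set where
    act : Act → Label
    τ   : Label

  infix 4 _─[_]→_
  data _─[_]→_ : Mon → Label → Mon → Set where
    actT   : ∀ {a m} → (a ∙ m) ─[ act a ]→ m
    recT   : ∀ {m} → rec m ─[ τ ]→ unfold m
    selL   : ∀ {m n μ m'} → m ─[ μ ]→ m' → (m + n) ─[ μ ]→ m'
    selR   : ∀ {m n μ m'} → m ─[ μ ]→ m' → (n + m) ─[ μ ]→ m'
    verdT  : ∀ {v a} → verd v ─[ act a ]→ verd v
    ⊗A     : ∀ {a m m' n n'} → m ─[ act a ]→ m' → n ─[ act a ]→ n' → (m ⊗ n) ─[ act a ]→ (m' ⊗ n')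
    ⊕A     : ∀ {a m m' n n'} → m ─[ act a ]→ m' → n ─[ act a ]→ n' → (m ⊕ n) ─[ act a ]→ (m' ⊕ n')
    ⊗L     : ∀ {m m' n} → m ─[ τ ]→ m' → (m ⊗ n) ─[ τ ]→ (m' ⊗ n)
    ⊗R     : ∀ {m m' n} → m ─[ τ ]→ m' → (n ⊗ m) ─[ τ ]→ (n ⊗ m')
    ⊕L     : ∀ {m m' n} → m ─[ τ ]→ m' → (m ⊕ n) ─[ τ ]→ (m' ⊕ n)
    ⊕R     : ∀ {m m' n} → m ─[ τ ]→ m' → (n ⊕ m) ─[ τ ]→ (n ⊕ m')
    ⊗end   : verd end ⊗ verd end ─[ τ ]→ verd end
    ⊕end   : verd end ⊕ verd end ─[ τ ]→ verd end
    ⊗yesL  : ∀ {m} → verd yes ⊗ m ─[ τ ]→ m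
    ⊗yesR  : ∀ {m} → m ⊗ verd yes ─[ τ ]→ m
    ⊗noL   : ∀ {m} → verd no ⊗ m ─[ τ ]→ verd no
    ⊗noR   : ∀ {m} → m ⊗ verd no ─[ τ ]→ verd no
    ⊕noL   : ∀ {m} → verd no ⊕ m ─[ τ ]→ m
    ⊕noR   : ∀ {m} → m ⊕ verd no ─[ τ ]→ m
    ⊕yesL  : ∀ {m} → verd yes ⊕ m ─[ τ ]→ verd yes
    ⊕yesR  : ∀ {m} → m ⊕ verd yes ─[ τ ]→ verd yes

  _⇒_ : Mon → Mon → Set
  _⇒_ = Star (λ m n → m ─[ τ ]→ n)

  _=[_]⇒_ : Mon → Act → Mon → Set
  m =[ a ]⇒ n = ∃ λ m₁ → ∃ λ m₂ → (m ⇒ m₁) × (m₁ ─[ act a ]→ m₂) × (m₂ ⇒ n)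

  data _=[_]⇒*_ : Mon → List Act → Mon → Set where
    nil  : ∀ {m n} → m ⇒ n → m =[ [] ]⇒* n
    cons : ∀ {m m' n a s} → m =[ a ]⇒ m' → m' =[ s ]⇒* n → m =[ a ∷ s ]⇒* n

  Reach : Mon → Mon → Set
  Reach m n = Star (λ p q → ∃ λ μ → p ─[ μ ]→ q) m n

  Reactive : Mon → Set
  Reactive m = ∀ n → Reach m n → ∀ (a : Act) → ∃ λ n' → n =[ a ]⇒ n'

  Trace : Set
  Trace = ℕ → Act

  prefix : Trace → ℕ → List Act
  prefix t zero = []
  prefix t (suc i) = t zero ∷ prefix (λ j → t (suc j)) i

  Rejects : Mon → Trace → Set
  Rejects m t = ∃ λ i → m =[ prefix t i ]⇒* verd no

  Accepts : Mon → Trace → Set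
  Accepts m t = ∃ λ i → m =[ prefix t i ]⇒* verd yes

-- The two parallel operators are dual: ⊗ has neutral verdict yes and absorbing verdict no, ⊕ the
-- other way round, so all four claims are two statements about an operator with a neutral and an
-- absorbing verdict. A weak trace of m₁ ⟨o⟩ m₂ either never evaluates its verdicts or decomposes
-- into equal-length traces of m₁ and m₂ ending in verdicts, one evaluation step, and a trace of the
-- result. Verdicts persist along every trace, so a verdict reached by one component on a prefix is
-- still there on any longer prefix. Conversely, traces of the components with the same actions run
-- in lockstep in the composite; when only one component reaches the absorbing verdict, reactivity
-- of the other provides the partner trace.
module Submission where

open import Defs
open import Data.Nat using (ℕ; zero; suc)
import Data.Nat as ℕ
open import Data.Nat.Properties using (+-comm)
open import Data.Empty using (⊥-elim)
open import Data.List using (List; []; _∷_; _++_)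
open import Data.Product as Product using (_×_; _,_; ∃; proj₂)
open import Data.Sum as Sum using (_⊎_; inj₁; inj₂)
open import Function.Bundles using (_⇔_; mk⇔)
open import Relation.Binary.PropositionalEquality using (_≡_; _≢_; refl; cong; subst; sym)
open import Relation.Binary.Construct.Closure.ReflexiveTransitive using (ε; _◅_; _◅◅_; gmap)

module _ (k : ℕ) where
  open Monitors k hiding (subst)

  data Par : Set where
    conj disj : Par

  infix 25 _⟨_⟩_
  _⟨_⟩_ : Mon → Par → Mon → Mon
  m ⟨ conj ⟩ n = m ⊗ n
  m ⟨ disj ⟩ n = m ⊕ n

  neutral absorbing : Par → Verdict
  neutral conj = yes
  neutral disj = no
  absorbing conj = no
  absorbing disj = yes

  verd≢par : ∀ o {v p q} → verd v ≢ p ⟨ o ⟩ q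
  verd≢par conj ()
  verd≢par disj ()

  neutral≢end : ∀ o → verd (neutral o) ≢ verd end
  neutral≢end conj ()
  neutral≢end disj ()

  absorbing≢end : ∀ o → verd (absorbing o) ≢ verd end
  absorbing≢end conj ()
  absorbing≢end disj ()

  neutral≢absorbing : ∀ o → verd (neutral o) ≢ verd (absorbing o)
  neutral≢absorbing conj ()
  neutral≢absorbing disj ()

  data Collapse (o : Par) : Mon → Mon → Mon → Set where
    end-end    : Collapse o (verd end) (verd end) (verd end)
    neutralˡ   : ∀ {q} → Collapse o (verd (neutral o)) q q
    neutralʳ   : ∀ {p} → Collapse o p (verd (neutral o)) p
    absorbingˡ : ∀ {q} → Collapse o (verd (absorbing o)) q (verd (absorbing o))
    absorbingʳ : ∀ {p} → Collapse o p (verd (absorbing o)) (verd (absorbing o))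

  data ParStep (o : Par) (m n : Mon) : Label → Mon → Set where
    left     : ∀ {m'} → m ─[ τ ]→ m' → ParStep o m n τ (m' ⟨ o ⟩ n)
    right    : ∀ {n'} → n ─[ τ ]→ n' → ParStep o m n τ (m ⟨ o ⟩ n')
    sync     : ∀ {a m' n'} → m ─[ act a ]→ m' → n ─[ act a ]→ n' → ParStep o m n (act a) (m' ⟨ o ⟩ n')
    collapse : ∀ {r} → Collapse o m n r → ParStep o m n τ r

  par-step : ∀ o {m n μ r} → ParStep o m n μ r → m ⟨ o ⟩ n ─[ μ ]→ r
  par-step conj (left x)              = ⊗L x
  par-step conj (right x)             = ⊗R x
  par-step conj (sync x y)            = ⊗A x y
  par-step conj (collapse end-end)    = ⊗end
  par-step conj (collapse neutralˡ)   = ⊗yesL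
  par-step conj (collapse neutralʳ)   = ⊗yesR
  par-step conj (collapse absorbingˡ) = ⊗noL
  par-step conj (collapse absorbingʳ) = ⊗noR
  par-step disj (left x)              = ⊕L x
  par-step disj (right x)             = ⊕R x
  par-step disj (sync x y)            = ⊕A x y
  par-step disj (collapse end-end)    = ⊕end
  par-step disj (collapse neutralˡ)   = ⊕noL
  par-step disj (collapse neutralʳ)   = ⊕noR
  par-step disj (collapse absorbingˡ) = ⊕yesL
  par-step disj (collapse absorbingʳ) = ⊕yesR

  par-step-view : ∀ o {m n μ r} → m ⟨ o ⟩ n ─[ μ ]→ r → ParStep o m n μ r
  par-step-view conj (⊗A x y) = sync x y
  par-step-view conj (⊗L x)   = left x
  par-step-view conj (⊗R x)   = right x
  par-step-view conj ⊗end     = collapse end-end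
  par-step-view conj ⊗yesL    = collapse neutralˡ
  par-step-view conj ⊗yesR    = collapse neutralʳ
  par-step-view conj ⊗noL     = collapse absorbingˡ
  par-step-view conj ⊗noR     = collapse absorbingʳ
  par-step-view disj (⊕A x y) = sync x y
  par-step-view disj (⊕L x)   = left x
  par-step-view disj (⊕R x)   = right x
  par-step-view disj ⊕end     = collapse end-end
  par-step-view disj ⊕noL     = collapse neutralˡ
  par-step-view disj ⊕noR     = collapse neutralʳ
  par-step-view disj ⊕yesL    = collapse absorbingˡ
  par-step-view disj ⊕yesR    = collapse absorbingʳ

  infixr 5 _◅*_ _++ʷ_
  infixl 5 _▻*_

  _◅*_ : ∀ {m p s n} → m ⇒ p → p =[ s ]⇒* n → m =[ s ]⇒* n
  st ◅* nil st′                        = nil (st ◅◅ st′)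
  st ◅* cons (_ , _ , st₁ , x , st₂) r = cons (_ , _ , st ◅◅ st₁ , x , st₂) r

  _▻*_ : ∀ {m s p n} → m =[ s ]⇒* p → p ⇒ n → m =[ s ]⇒* n
  nil st   ▻* st′ = nil (st ◅◅ st′)
  cons w r ▻* st′ = cons w (r ▻* st′)

  _++ʷ_ : ∀ {m s₁ p s₂ n} → m =[ s₁ ]⇒* p → p =[ s₂ ]⇒* n → m =[ s₁ ++ s₂ ]⇒* n
  nil st   ++ʷ r′ = st ◅* r′
  cons w r ++ʷ r′ = cons w (r ++ʷ r′)

  verdict-loop : ∀ v s → verd v =[ s ]⇒* verd v
  verdict-loop v []      = nil ε
  verdict-loop v (a ∷ s) = cons (_ , _ , ε , verdT , ε) (verdict-loop v s)

  verdict-stable : ∀ {v s n} → verd v =[ s ]⇒* n → n ≡ verd v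
  verdict-stable (nil ε)                          = refl
  verdict-stable (nil (() ◅ _))
  verdict-stable (cons (_ , _ , ε , verdT , ε) r) = verdict-stable r
  verdict-stable (cons (_ , _ , () ◅ _ , _ , _) _)
  verdict-stable (cons (_ , _ , ε , verdT , () ◅ _) _)

  verdict-extend : ∀ {m s₁ v} s₂ → m =[ s₁ ]⇒* verd v → m =[ s₁ ++ s₂ ]⇒* verd v
  verdict-extend {v = v} s₂ r = r ++ʷ verdict-loop v s₂

  parˡ* : ∀ o {m m′ n} → m ⇒ m′ → m ⟨ o ⟩ n ⇒ m′ ⟨ o ⟩ n
  parˡ* o = gmap _ (λ x → par-step o (left x))

  parʳ* : ∀ o {m n n′} → n ⇒ n′ → m ⟨ o ⟩ n ⇒ m ⟨ o ⟩ n′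
  parʳ* o = gmap _ (λ x → par-step o (right x))

  par-weak-step : ∀ o {a m m′ n n′} → m =[ a ]⇒ m′ → n =[ a ]⇒ n′ → m ⟨ o ⟩ n =[ a ]⇒ m′ ⟨ o ⟩ n′
  par-weak-step o (_ , _ , st₁ , x , st₁′) (_ , _ , st₂ , y , st₂′) =
    _ , _ , parˡ* o st₁ ◅◅ parʳ* o st₂ , par-step o (sync x y) , parˡ* o st₁′ ◅◅ parʳ* o st₂′

  par-trace : ∀ o {s m p n q} → m =[ s ]⇒* p → n =[ s ]⇒* q → m ⟨ o ⟩ n =[ s ]⇒* p ⟨ o ⟩ q
  par-trace o (nil st₁)    (nil st₂)    = nil (parˡ* o st₁ ◅◅ parʳ* o st₂)
  par-trace o (cons w₁ r₁) (cons w₂ r₂) = cons (par-weak-step o w₁ w₂) (par-trace o r₁ r₂)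

  data τ-Decomposition (o : Par) (m n r : Mon) : Set where
    unresolved : ∀ {p q} → m ⇒ p → n ⇒ q → r ≡ p ⟨ o ⟩ q → τ-Decomposition o m n r
    resolved   : ∀ {p q r′} → m ⇒ p → n ⇒ q → Collapse o p q r′ → r′ ⇒ r → τ-Decomposition o m n r

  τ-decompose : ∀ o {m n r} → m ⟨ o ⟩ n ⇒ r → τ-Decomposition o m n r
  τ-decompose o ε = unresolved ε ε refl
  τ-decompose o (x ◅ st) with par-step-view o x
  ... | collapse c = resolved ε ε c st
  ... | left y with τ-decompose o st
  ...   | unresolved st₁ st₂ e   = unresolved (y ◅ st₁) st₂ e
  ...   | resolved st₁ st₂ c st′ = resolved (y ◅ st₁) st₂ c st′
  τ-decompose o (x ◅ st) | right y with τ-decompose o st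
  ...   | unresolved st₁ st₂ e   = unresolved st₁ (y ◅ st₂) e
  ...   | resolved st₁ st₂ c st′ = resolved st₁ (y ◅ st₂) c st′

  data Decomposition (o : Par) (m₁ m₂ : Mon) : List Act → Mon → Set where
    unresolved : ∀ {s p q n} → n ≡ p ⟨ o ⟩ q → Decomposition o m₁ m₂ s n
    resolved   : ∀ {s₁ s₂ p q r n} → m₁ =[ s₁ ]⇒* p → m₂ =[ s₁ ]⇒* q → Collapse o p q r → r =[ s₂ ]⇒* n →
                 Decomposition o m₁ m₂ (s₁ ++ s₂) n

  decompose : ∀ o {m₁ m₂ s n} → m₁ ⟨ o ⟩ m₂ =[ s ]⇒* n → Decomposition o m₁ m₂ s n
  decompose o (nil st) with τ-decompose o st
  ... | unresolved _ _ e        = unresolved e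
  ... | resolved st₁ st₂ c st′ = resolved (nil st₁) (nil st₂) c (nil st′)
  decompose o (cons (_ , _ , st , x , st′) r) with τ-decompose o st
  ... | resolved st₁ st₂ c st″ = resolved (nil st₁) (nil st₂) c (cons (_ , _ , st″ , x , st′) r)
  ... | unresolved st₁ st₂ refl with par-step-view o x
  ...   | sync y₁ y₂ with τ-decompose o st′
  ...     | resolved st₁′ st₂′ c st″ =
              resolved (cons (_ , _ , st₁ , y₁ , st₁′) (nil ε)) (cons (_ , _ , st₂ , y₂ , st₂′) (nil ε)) c (st″ ◅* r)
  ...     | unresolved st₁′ st₂′ refl with decompose o r
  ...       | unresolved e        = unresolved e
  ...       | resolved r₁ r₂ c r′ = resolved (cons (_ , _ , st₁ , y₁ , st₁′) r₁) (cons (_ , _ , st₂ , y₂ , st₂′) r₂) c r′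

  absorbing-elim : ∀ o {m₁ m₂ s} → m₁ ⟨ o ⟩ m₂ =[ s ]⇒* verd (absorbing o) →
                   m₁ =[ s ]⇒* verd (absorbing o) ⊎ m₂ =[ s ]⇒* verd (absorbing o)
  absorbing-elim o r with decompose o r
  ... | unresolved e                = ⊥-elim (verd≢par o e)
  ... | resolved _ _ end-end r′     = ⊥-elim (absorbing≢end o (verdict-stable r′))
  ... | resolved _ r₂ neutralˡ r′    = inj₂ (r₂ ++ʷ r′)
  ... | resolved r₁ _ neutralʳ r′    = inj₁ (r₁ ++ʷ r′)
  ... | resolved r₁ _ absorbingˡ _   = inj₁ (verdict-extend _ r₁)
  ... | resolved _ r₂ absorbingʳ _   = inj₂ (verdict-extend _ r₂)

  neutral-elim : ∀ o {m₁ m₂ s} → m₁ ⟨ o ⟩ m₂ =[ s ]⇒* verd (neutral o) →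
                 m₁ =[ s ]⇒* verd (neutral o) × m₂ =[ s ]⇒* verd (neutral o)
  neutral-elim o r with decompose o r
  ... | unresolved e                 = ⊥-elim (verd≢par o e)
  ... | resolved _ _ end-end r′      = ⊥-elim (neutral≢end o (verdict-stable r′))
  ... | resolved r₁ r₂ neutralˡ r′   = verdict-extend _ r₁ , r₂ ++ʷ r′
  ... | resolved r₁ r₂ neutralʳ r′   = r₁ ++ʷ r′ , verdict-extend _ r₂
  ... | resolved _ _ absorbingˡ r′   = ⊥-elim (neutral≢absorbing o (verdict-stable r′))
  ... | resolved _ _ absorbingʳ r′   = ⊥-elim (neutral≢absorbing o (verdict-stable r′))

  collapse-trace : ∀ o {m₁ m₂ s p q r} → m₁ =[ s ]⇒* p → m₂ =[ s ]⇒* q → Collapse o p q r → m₁ ⟨ o ⟩ m₂ =[ s ]⇒* r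
  collapse-trace o r₁ r₂ c = par-trace o r₁ r₂ ▻* (par-step o (collapse c) ◅ ε)

  weak-step-reach : ∀ {m a n} → m =[ a ]⇒ n → Reach m n
  weak-step-reach (_ , _ , st , x , st′) = τ*-reach st ◅◅ (_ , x) ◅ τ*-reach st′
    where
      τ*-reach : ∀ {m n} → m ⇒ n → Reach m n
      τ*-reach = gmap _ (τ ,_)

  reactive-trace : ∀ {m} → Reactive m → ∀ s → ∃ λ n → m =[ s ]⇒* n
  reactive-trace R = from-reachable ε
    where
      from-reachable : ∀ {n} → Reach _ n → ∀ s → ∃ λ n′ → n =[ s ]⇒* n′
      from-reachable {n} _ []     = n , nil ε
      from-reachable {n} ρ (a ∷ s) with R n ρ a
      ... | _ , w = Product.map₂ (cons w) (from-reachable (ρ ◅◅ weak-step-reach w) s)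

  Reaches : Verdict → Mon → Trace → Set
  Reaches v m t = ∃ λ i → m =[ prefix t i ]⇒* verd v

  prefix-+ : ∀ t i d → prefix t (i ℕ.+ d) ≡ prefix t i ++ prefix (λ j → t (i ℕ.+ j)) d
  prefix-+ t zero    d = refl
  prefix-+ t (suc i) d = cong (t zero ∷_) (prefix-+ (λ j → t (suc j)) i d)

  reaches-extend : ∀ {m v t i} d → m =[ prefix t i ]⇒* verd v → m =[ prefix t (i ℕ.+ d) ]⇒* verd v
  reaches-extend {m} {v} {t} {i} d r =
    subst (λ s → m =[ s ]⇒* verd v) (sym (prefix-+ t i d)) (verdict-extend _ r)

  common-prefix : ∀ {v w m n t} → Reaches v m t → Reaches w n t →
                  ∃ λ i → m =[ prefix t i ]⇒* verd v × n =[ prefix t i ]⇒* verd w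
  common-prefix {w = w} {n = n} {t} (i , r₁) (j , r₂) =
    i ℕ.+ j , reaches-extend j r₁ , subst (λ l → n =[ prefix t l ]⇒* verd w) (+-comm j i) (reaches-extend i r₂)

  absorbing-reaches : ∀ o {m₁ m₂ t} → Reactive m₁ → Reactive m₂ →
                      Reaches (absorbing o) (m₁ ⟨ o ⟩ m₂) t ⇔ (Reaches (absorbing o) m₁ t ⊎ Reaches (absorbing o) m₂ t)
  absorbing-reaches o R₁ R₂ = mk⇔
    (λ (i , r) → Sum.map (i ,_) (i ,_) (absorbing-elim o r))
    λ { (inj₁ (i , r₁)) → i , collapse-trace o r₁ (proj₂ (reactive-trace R₂ _)) absorbingˡ
      ; (inj₂ (i , r₂)) → i , collapse-trace o (proj₂ (reactive-trace R₁ _)) r₂ absorbingʳ }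

  neutral-reaches : ∀ o {m₁ m₂ t} →
                    Reaches (neutral o) (m₁ ⟨ o ⟩ m₂) t ⇔ (Reaches (neutral o) m₁ t × Reaches (neutral o) m₂ t)
  neutral-reaches o = mk⇔
    (λ (i , r) → Product.map (i ,_) (i ,_) (neutral-elim o r))
    (λ (ρ₁ , ρ₂) → let (i , r₁ , r₂) = common-prefix ρ₁ ρ₂ in i , collapse-trace o r₁ r₂ neutralˡ)

mainTheorem2 : (k : ℕ) → let open Monitors k in
    (m₁ m₂ : Mon) → Reactive m₁ → Reactive m₂ → (t : Trace) →
      (Rejects (m₁ ⊗ m₂) t ⇔ (Rejects m₁ t ⊎ Rejects m₂ t))
      × (Accepts (m₁ ⊗ m₂) t ⇔ (Accepts m₁ t × Accepts m₂ t))
      × (Rejects (m₁ ⊕ m₂) t ⇔ (Rejects m₁ t × Rejects m₂ t))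
      × (Accepts (m₁ ⊕ m₂) t ⇔ (Accepts m₁ t ⊎ Accepts m₂ t))
mainTheorem2 k _ _ R₁ R₂ _ =
    absorbing-reaches k conj R₁ R₂
  , neutral-reaches k conj
  , neutral-reaches k disj
  , absorbing-reaches k disj R₁ R₂
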